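{- Let $\mathcal{M}'=(\mathcal{N}',\mathcal{I}',w)$ be an $\varepsilon^{ -1}$-spread weighted matroid with weight intervals $L_i=[l_i,r_i]$, $i\ge0$. For each $t$ let $S'_t$ be an independent set of $\mathcal{M}'|L_t$, and let $I'\in\mathcal{I}'$ with $I'\subseteq\bigcup_{t\ge j}S'_t$. Let $\{e_1,\dots,e_l\}\subseteq S'_j$ be the set of elements of $S'_j$ spanned by $I'$, and for each $t\in[l]$ let $C_t$ be the unique circuit in $I'\cup\{e_t\}$. Then $\left|\left(\bigcup_{t=1}^l C_t\right)\cap(I'\setminus S'_j)\right|\ge l$.
   Context: $\varepsilon^{ -1}$-spread: there are disjoint weight intervals $[l_i,r_i]$ with $l_{i+1}>r_i\varepsilon^{ -1}$ such that the sets $\{e: w(e)\in[l_i,r_i]\}$ partition the ground set. $\mathcal{M}'|L_t$ is the restriction to elements with weight in $L_t$. A set $S$ spans an element $e$ if $S\cup\{e\}\notin\mathcal{I}'$. A circuit is a minimal dependent set.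
   Formalization: The weights w, the interval endpoints $l_i$ and $r_i$, and the parameter ε are rational rather than real. -}

module Defs where

open import Data.Nat using (ℕ; _≥_) renaming (suc to sucℕ; _<_ to _<ℕ_)
open import Data.Fin using (Fin)
open import Data.Fin.Subset using (Subset; _∈_; _∉_; _⊆_; _⊂_; _∪_; ⁅_⁆; ∣_∣; ⋃; ⊥)
open import Data.Vec using (lookup)
open import Data.List using (List; map; allFin)
open import Data.Bool using (if_then_else_)
open import Data.Rational using (ℚ; _≤_; _<_; _*_; 1/_; NonZero)
open import Data.Product using (Σ; _×_; ∃)
open import Relation.Nullary using (¬_)
open import Relation.Binary.PropositionalEquality using (_≡_)

record Matroid (n : ℕ) : Set₁ where
  field
    Indep     : Subset n → Set
    indep-⊥   : Indep ⊥
    indep-⊆   : ∀ {A B} → A ⊆ B → Indep B → Indep A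
    exchange  : ∀ {A B} → Indep A → Indep B → ∣ A ∣ <ℕ ∣ B ∣ →
                Σ (Fin n) λ x → x ∈ B × x ∉ A × Indep (A ∪ ⁅ x ⁆)
open Matroid public

Spans : ∀ {n} → Matroid n → Subset n → Fin n → Set
Spans M S e = ¬ Indep M (S ∪ ⁅ e ⁆)

IsCircuit : ∀ {n} → Matroid n → Subset n → Set
IsCircuit M C = ¬ Indep M C × (∀ D → D ⊂ C → Indep M D)

InInterval : ℚ → ℚ → ℚ → Set
InInterval a b x = a ≤ x × x ≤ b

IsSpread : ∀ {n} (ε : ℚ) .{{_ : NonZero ε}} (w : Fin n → ℚ) (l r : ℕ → ℚ) → Set
IsSpread {n} ε w l r =
    (∀ i → l i ≤ r i)
  × (∀ i → r i * (1/ ε) < l (sucℕ i))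
  × (∀ (e : Fin n) → Σ ℕ λ i → InInterval (l i) (r i) (w e)
                       × (∀ k → InInterval (l k) (r k) (w e) → k ≡ i))

-- S is independent in the restriction M | L_t.
IndepRestr : ∀ {n} → Matroid n → (w : Fin n → ℚ) → ℚ → ℚ → Subset n → Set
IndepRestr M w a b S = Indep M S × (∀ e → e ∈ S → InInterval a b (w e))

BigUnion : ∀ {n} → Subset n → (Fin n → Subset n) → Subset n
BigUnion {n} E C = ⋃ (map (λ e → if lookup E e then C e else ⊥) (allFin n))

{-# OPTIONS --safe #-}
module Submission where

-- Put A = I ∩ S_j and X = (⋃ C_e) ∩ (I ─ S_j).  The set E ∪ A ⊆ S_j is
-- independent, and E misses A because an independent set spans none of its own
-- members.  Every e ∈ E is spanned by X ∪ A ⊆ I, as C_e ⊆ X ∪ A ∪ {e}; so the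
-- exchange axiom gives ∣E∣ + ∣A∣ = ∣E ∪ A∣ ≤ ∣X ∪ A∣ ≤ ∣X∣ + ∣A∣.

open import Defs
open import Data.Nat using (ℕ; _≥_; suc; _+_) renaming (_≤_ to _≤ℕ_; _<_ to _<ℕ_)
open import Data.Nat.Properties using (+-suc; +-identityʳ; ≤-trans; ≤-reflexive; ≮⇒≥; +-cancelʳ-≤; m≤m+n; module ≤-Reasoning)
open import Data.Fin using (Fin)
open import Data.Fin.Subset
  using (Subset; inside; outside; _∈_; _∉_; _⊆_; _∪_; _∩_; _─_; ⁅_⁆; ∣_∣; ⋃; Empty)
import Data.Fin.Subset as Subset
open import Data.Fin.Subset.Properties
  using (x∈p∪q⁺; x∈p∪q⁻; x∈p∩q⁺; x∈p∩q⁻; x∈p∧x∉q⇒x∈p─q; p─q⊆p; x∈⁅y⁆⇒x≡y;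
         _∈?_; Empty-unique; ∣⊥∣≡0)
open import Data.Rational using (ℚ; _<_; 0ℚ; NonZero)
open import Data.Product using (Σ; _×_; _,_; proj₁; proj₂)
open import Data.Sum using (inj₁; inj₂)
open import Data.Empty using (⊥-elim)
open import Data.Bool using (if_then_else_)
open import Data.Vec using (_∷_; []; lookup)
open import Data.Vec.Properties using ([]=⇒lookup)
open import Data.List using (List; map; allFin)
import Data.List as List
open import Data.List.Membership.Propositional using () renaming (_∈_ to _∈ₗ_)
open import Data.List.Membership.Propositional.Properties using (∈-map⁺; ∈-allFin)
open import Data.List.Relation.Unary.Any using (here; there)
open import Function using (_∘_)
open import Function.Bundles using (_⇔_; Equivalence)
open import Relation.Nullary using (yes; no; ¬_)
open import Relation.Binary.PropositionalEquality using (_≡_; refl; sym; cong; subst; module ≡-Reasoning)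

∣p∪q∣+∣p∩q∣≡∣p∣+∣q∣ : ∀ {n} (p q : Subset n) → ∣ p ∪ q ∣ + ∣ p ∩ q ∣ ≡ ∣ p ∣ + ∣ q ∣
∣p∪q∣+∣p∩q∣≡∣p∣+∣q∣ []            []            = refl
∣p∪q∣+∣p∩q∣≡∣p∣+∣q∣ (outside ∷ p) (outside ∷ q) = ∣p∪q∣+∣p∩q∣≡∣p∣+∣q∣ p q
∣p∪q∣+∣p∩q∣≡∣p∣+∣q∣ (inside  ∷ p) (outside ∷ q) = cong suc (∣p∪q∣+∣p∩q∣≡∣p∣+∣q∣ p q)
∣p∪q∣+∣p∩q∣≡∣p∣+∣q∣ (outside ∷ p) (inside  ∷ q) = begin
  suc (∣ p ∪ q ∣ + ∣ p ∩ q ∣) ≡⟨ cong suc (∣p∪q∣+∣p∩q∣≡∣p∣+∣q∣ p q) ⟩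
  suc (∣ p ∣ + ∣ q ∣)         ≡⟨ sym (+-suc ∣ p ∣ ∣ q ∣) ⟩
  ∣ p ∣ + suc ∣ q ∣           ∎
  where open ≡-Reasoning
∣p∪q∣+∣p∩q∣≡∣p∣+∣q∣ (inside  ∷ p) (inside  ∷ q) = begin
  suc (∣ p ∪ q ∣ + suc ∣ p ∩ q ∣)   ≡⟨ cong suc (+-suc ∣ p ∪ q ∣ ∣ p ∩ q ∣) ⟩
  suc (suc (∣ p ∪ q ∣ + ∣ p ∩ q ∣)) ≡⟨ cong (suc ∘ suc) (∣p∪q∣+∣p∩q∣≡∣p∣+∣q∣ p q) ⟩
  suc (suc (∣ p ∣ + ∣ q ∣))         ≡⟨ cong suc (sym (+-suc ∣ p ∣ ∣ q ∣)) ⟩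
  suc (∣ p ∣ + suc ∣ q ∣)           ∎
  where open ≡-Reasoning

∣p∪q∣≤∣p∣+∣q∣ : ∀ {n} (p q : Subset n) → ∣ p ∪ q ∣ ≤ℕ ∣ p ∣ + ∣ q ∣
∣p∪q∣≤∣p∣+∣q∣ p q = ≤-trans (m≤m+n ∣ p ∪ q ∣ ∣ p ∩ q ∣) (≤-reflexive (∣p∪q∣+∣p∩q∣≡∣p∣+∣q∣ p q))

Empty[p∩q]⇒∣p∣+∣q∣≡∣p∪q∣ : ∀ {n} (p q : Subset n) → Empty (p ∩ q) → ∣ p ∣ + ∣ q ∣ ≡ ∣ p ∪ q ∣
Empty[p∩q]⇒∣p∣+∣q∣≡∣p∪q∣ {n} p q p∩q-empty = begin
  ∣ p ∣ + ∣ q ∣                 ≡⟨ sym (∣p∪q∣+∣p∩q∣≡∣p∣+∣q∣ p q) ⟩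
  ∣ p ∪ q ∣ + ∣ p ∩ q ∣         ≡⟨ cong (λ s → ∣ p ∪ q ∣ + ∣ s ∣) (Empty-unique p∩q-empty) ⟩
  ∣ p ∪ q ∣ + ∣ Subset.⊥ {n} ∣  ≡⟨ cong (∣ p ∪ q ∣ +_) (∣⊥∣≡0 n) ⟩
  ∣ p ∪ q ∣ + 0                 ≡⟨ +-identityʳ ∣ p ∪ q ∣ ⟩
  ∣ p ∪ q ∣                     ∎
  where open ≡-Reasoning

x∈p∧p∈ps⇒x∈⋃ps : ∀ {n} {x : Fin n} {p : Subset n} (ps : List (Subset n)) →
                  x ∈ p → p ∈ₗ ps → x ∈ ⋃ ps
x∈p∧p∈ps⇒x∈⋃ps (q List.∷ ps) x∈p (here refl)  = x∈p∪q⁺ (inj₁ x∈p)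
x∈p∧p∈ps⇒x∈⋃ps (q List.∷ ps) x∈p (there p∈ps) = x∈p∪q⁺ {p = q} (inj₂ (x∈p∧p∈ps⇒x∈⋃ps ps x∈p p∈ps))

∈-BigUnion⁺ : ∀ {n} (E : Subset n) (C : Fin n → Subset n) {e x : Fin n} →
              e ∈ E → x ∈ C e → x ∈ BigUnion E C
∈-BigUnion⁺ {n} E C {e} {x} e∈E x∈Ce =
  x∈p∧p∈ps⇒x∈⋃ps (map member (allFin n)) x∈member (∈-map⁺ member (∈-allFin e))
  where
  member : Fin n → Subset n
  member f = if lookup E f then C f else Subset.⊥
  x∈member : x ∈ member e
  x∈member rewrite []=⇒lookup e∈E = x∈Ce

module _ {n} (M : Matroid n) where

  dependent-⊆⇒Spans : ∀ {D Y e} → ¬ Indep M D → D ⊆ Y ∪ ⁅ e ⁆ → Spans M Y e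
  dependent-⊆⇒Spans D-dep D⊆Y+e Y+e-indep = D-dep (indep-⊆ M D⊆Y+e Y+e-indep)

  Indep⇒¬Spans-member : ∀ {I x} → Indep M I → x ∈ I → ¬ Spans M I x
  Indep⇒¬Spans-member {I} {x} I-indep x∈I I-spans-x = I-spans-x (indep-⊆ M I+x⊆I I-indep)
    where
    I+x⊆I : I ∪ ⁅ x ⁆ ⊆ I
    I+x⊆I {y} y∈I+x with x∈p∪q⁻ I ⁅ x ⁆ y∈I+x
    ... | inj₁ y∈I = y∈I
    ... | inj₂ y∈x = subst (_∈ I) (sym (x∈⁅y⁆⇒x≡y x y∈x)) x∈I

  Spans⇒∣Indep∣≤∣Indep∣ : ∀ {B Y} → Indep M B → Indep M Y →
                           (∀ x → x ∈ B → x ∉ Y → Spans M Y x) → ∣ B ∣ ≤ℕ ∣ Y ∣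
  Spans⇒∣Indep∣≤∣Indep∣ {B} {Y} B-indep Y-indep Y-spans = ≮⇒≥ ∣Y∣≮∣B∣
    where
    ∣Y∣≮∣B∣ : ¬ ∣ Y ∣ <ℕ ∣ B ∣
    ∣Y∣≮∣B∣ ∣Y∣<∣B∣ with exchange M Y-indep B-indep ∣Y∣<∣B∣
    ... | x , x∈B , x∉Y , Y+x-indep = Y-spans x x∈B x∉Y Y+x-indep

lemma7 : ∀ {n} (M : Matroid n) (w : Fin n → ℚ) (ε : ℚ) .{{_ : NonZero ε}}
         (l r : ℕ → ℚ) → 0ℚ < ε → IsSpread ε w l r →
         (S : ℕ → Subset n) → (∀ t → IndepRestr M w (l t) (r t) (S t)) →
         (j : ℕ) (I : Subset n) → Indep M I →
         (∀ x → x ∈ I → Σ ℕ λ t → t ≥ j × x ∈ S t) →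
         (E : Subset n) → (∀ e → (e ∈ E) ⇔ (e ∈ S j × Spans M I e)) →
         (C : Fin n → Subset n) →
         (∀ e → e ∈ E → IsCircuit M (C e) × C e ⊆ I ∪ ⁅ e ⁆) →
         ∣ E ∣ ≤ℕ ∣ BigUnion E C ∩ (I ─ S j) ∣
lemma7 M _ _ _ _ _ _ S S-indep j I I-indep _ E E⇔ C circuits =
  +-cancelʳ-≤ _ _ _ (begin
    ∣ E ∣ + ∣ A ∣  ≡⟨ Empty[p∩q]⇒∣p∣+∣q∣≡∣p∪q∣ E A E∩A-empty ⟩
    ∣ E ∪ A ∣      ≤⟨ Spans⇒∣Indep∣≤∣Indep∣ M E∪A-indep X∪A-indep X∪A-spans ⟩
    ∣ X ∪ A ∣      ≤⟨ ∣p∪q∣≤∣p∣+∣q∣ X A ⟩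
    ∣ X ∣ + ∣ A ∣  ∎)
  where
  open ≤-Reasoning
  A X : Subset _
  A = I ∩ S j
  X = BigUnion E C ∩ (I ─ S j)

  E⊆Sj : E ⊆ S j
  E⊆Sj {e} e∈E = proj₁ (Equivalence.to (E⇔ e) e∈E)

  I-spans-E : ∀ {e} → e ∈ E → Spans M I e
  I-spans-E {e} e∈E = proj₂ (Equivalence.to (E⇔ e) e∈E)

  E∩A-empty : Empty (E ∩ A)
  E∩A-empty (x , x∈E∩A) with x∈p∩q⁻ E A x∈E∩A
  ... | x∈E , x∈A = Indep⇒¬Spans-member M I-indep (proj₁ (x∈p∩q⁻ I (S j) x∈A)) (I-spans-E x∈E)

  E∪A-indep : Indep M (E ∪ A)
  E∪A-indep = indep-⊆ M E∪A⊆Sj (proj₁ (S-indep j))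
    where
    E∪A⊆Sj : E ∪ A ⊆ S j
    E∪A⊆Sj {x} x∈E∪A with x∈p∪q⁻ E A x∈E∪A
    ... | inj₁ x∈E = E⊆Sj x∈E
    ... | inj₂ x∈A = proj₂ (x∈p∩q⁻ I (S j) x∈A)

  X∪A-indep : Indep M (X ∪ A)
  X∪A-indep = indep-⊆ M X∪A⊆I I-indep
    where
    X∪A⊆I : X ∪ A ⊆ I
    X∪A⊆I {x} x∈X∪A with x∈p∪q⁻ X A x∈X∪A
    ... | inj₁ x∈X = p─q⊆p I (S j) (proj₂ (x∈p∩q⁻ (BigUnion E C) (I ─ S j) x∈X))
    ... | inj₂ x∈A = proj₁ (x∈p∩q⁻ I (S j) x∈A)

  C⊆X∪A+e : ∀ {e} → e ∈ E → C e ⊆ (X ∪ A) ∪ ⁅ e ⁆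
  C⊆X∪A+e {e} e∈E {y} y∈Ce with x∈p∪q⁻ I ⁅ e ⁆ (proj₂ (circuits e e∈E) y∈Ce)
  ... | inj₂ y∈e = x∈p∪q⁺ (inj₂ y∈e)
  ... | inj₁ y∈I with y ∈? S j
  ...   | yes y∈Sj = x∈p∪q⁺ (inj₁ (x∈p∪q⁺ (inj₂ (x∈p∩q⁺ (y∈I , y∈Sj)))))
  ...   | no  y∉Sj = x∈p∪q⁺ (inj₁ (x∈p∪q⁺ (inj₁
                       (x∈p∩q⁺ (∈-BigUnion⁺ E C e∈E y∈Ce , x∈p∧x∉q⇒x∈p─q y∈I y∉Sj)))))

  X∪A-spans : ∀ x → x ∈ E ∪ A → x ∉ X ∪ A → Spans M (X ∪ A) x
  X∪A-spans x x∈E∪A x∉X∪A with x∈p∪q⁻ E A x∈E∪A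
  ... | inj₁ x∈E = dependent-⊆⇒Spans M (proj₁ (proj₁ (circuits x x∈E))) (C⊆X∪A+e x∈E)
  ... | inj₂ x∈A = ⊥-elim (x∉X∪A (x∈p∪q⁺ (inj₂ x∈A)))
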